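{- Let $G=(V,E)$ be a graph with $|V|\ge1$ and minimum degree $\delta(G)\ge1$, whose vertices fail randomly and independently, vertex $v$ with probability $q_v=1-p_v$, $\mathbf{p}=(p_v)_{v\in V}\in[0,1]^V$. Then \[\operatorname{DRel}(G,\mathbf{p})=\sum_{\substack{J\subseteq V\\|J|\le|V|-\delta(G)}}(-1)^{|J|}\prod_{v\in N_G[J]}q_v+(-1)^{|V|-\delta(G)+1}\binom{|V|-1}{\delta(G)-1}\prod_{v\in V}q_v.\]
   Context: All graphs are finite, undirected and simple; edges never fail. $\operatorname{DRel}(G,\mathbf{p})$ is the probability that the set of operating vertices is a dominating set (every vertex not in it is adjacent to a vertex in it). $N_G[J]$ is the closed neighbourhood of $J$ (vertices in $J$ or adjacent to a vertex of $J$). $\delta(G)$ is the minimum degree of $G$. -}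

module Defs where

open import Level using (Level)
open import Data.Bool using (Bool; true; false; if_then_else_; _∧_; _∨_; not)
open import Data.Nat using (ℕ; zero; suc)
import Data.Nat as ℕ
open import Data.Fin using (Fin)
open import Data.Fin.Subset using (Subset)
open import Data.Vec using (Vec; []; _∷_; lookup)
open import Data.List using (List; []; _∷_; _++_; map; foldr; filter)
open import Data.Bool.ListAction using (any; all)
open import Data.Nat.ListAction using (sum)
open import Data.List.Base using (allFin)
open import Relation.Binary.PropositionalEquality using (_≡_)
open import Data.Product using (∃)
open import Algebra.Bundles using (CommutativeRing)

record Graph (n : ℕ) : Set where
  field
    adj    : Fin n → Fin n → Bool
    sym    : ∀ u v → adj u v ≡ adj v u
    irrefl : ∀ v → adj v v ≡ false
open Graph public

degree : ∀ {n} → Graph n → Fin n → ℕ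
degree {n} G v = sum (map (λ u → if adj G v u then 1 else 0) (allFin n))

IsMinDegree : ∀ {n} → Graph n → ℕ → Set
IsMinDegree {n} G δ = (∀ v → δ ℕ.≤ degree G v) Data.Product.× ∃ (λ v → degree G v ≡ δ)

allSubsets : (n : ℕ) → List (Subset n)
allSubsets zero = [] ∷ []
allSubsets (suc n) = map (false ∷_) (allSubsets n) ++ map (true ∷_) (allSubsets n)

inClosedNbhd : ∀ {n} → Graph n → Subset n → Fin n → Bool
inClosedNbhd {n} G J v = lookup J v ∨ any (λ u → lookup J u ∧ adj G u v) (allFin n)

isDominating : ∀ {n} → Graph n → Subset n → Bool
isDominating {n} G S = all (inClosedNbhd G S) (allFin n)

module _ {c ℓ : Level} (R : CommutativeRing c ℓ) where
  open CommutativeRing R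

  sumR : List Carrier → Carrier
  sumR = foldr _+_ 0#

  prodR : List Carrier → Carrier
  prodR = foldr _*_ 1#

  sign : ℕ → Carrier
  sign zero = 1#
  sign (suc k) = - 1# * sign k

  fromℕ : ℕ → Carrier
  fromℕ zero = 0#
  fromℕ (suc k) = 1# + fromℕ k

  qOf : ∀ {n} → (Fin n → Carrier) → Fin n → Carrier
  qOf p v = 1# - p v

  DRel : ∀ {n} → Graph n → (Fin n → Carrier) → Carrier
  DRel {n} G p =
    sumR (map (λ S → prodR (map (λ v → if lookup S v then p v else qOf p v) (allFin n)))
              (filter (λ S → Data.Bool.T? (isDominating G S)) (allSubsets n)))

  prodQClosedNbhd : ∀ {n} → Graph n → (Fin n → Carrier) → Subset n → Carrier
  prodQClosedNbhd {n} G p J =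
    prodR (map (λ v → if inClosedNbhd G J v then qOf p v else 1#) (allFin n))

-- Write q_v = 1 - p_v and, for a set S of operating vertices, [S dominates] = Π_v [v ∈ N[S]]
-- = Π_v (1 - [v ∉ N[S]]).  Expanding the product gives Σ_J (-1)^|J| [J ∩ N[S] = ∅], and
-- J ∩ N[S] = ∅ iff S ∩ N[J] = ∅.  Summing against the probability of S and exchanging the sums,
-- the inner sum over the S missing N[J] is Π_{v ∈ N[J]} q_v, so DRel = Σ_J (-1)^|J| Π_{N[J]} q_v.
-- If v ∉ N[J] then J, v and the neighbours of v are pairwise disjoint, so |J| + δ < |V|; hence
-- every J with |J| > |V| - δ has N[J] = V, and those terms add up to Π_V q_v times
-- Σ_{k > m} (-1)^k C(|V|, k) = (-1)^(m+1) C(|V| - 1, m) for m = |V| - δ.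
module Submission where

open import Defs hiding (sym)
open import Level using (Level)
open import Algebra.Bundles using (CommutativeRing; CommutativeSemiring)
open import Data.Bool using (Bool; true; false; T; T?; not; _∧_; if_then_else_)
open import Data.Bool.Properties using (T-∧; T-∨)
open import Data.Bool.ListAction using (all; any)
open import Data.Empty using (⊥-elim)
open import Data.Fin as Fin using (Fin)
open import Data.Fin.Subset using (Subset; ∣_∣)
open import Data.List using (List; []; _∷_; _++_; map; foldr; filter)
open import Data.List.Base using (allFin)
open import Data.List.Properties using (map-tabulate)
import Data.List.Relation.Unary.All as All
open import Data.List.Relation.Unary.All.Properties using (all⁺; all⁻)
open import Data.List.Relation.Unary.Any using (satisfied)
open import Data.List.Relation.Unary.Any.Properties using (any⁺; any⁻)
open import Data.List.Membership.Propositional using (lose)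
open import Data.List.Membership.Propositional.Properties using (∈-allFin)
open import Data.Nat as ℕ using (ℕ; zero; suc; _≤_; _<_; _∸_; _≤?_; _<?_; z≤n; s≤s)
import Data.Nat.Properties as ℕ
open import Data.Nat.Combinatorics using (_C_; nCk≡nC[n∸k]; nCk+nC[k+1]≡[n+1]C[k+1])
open import Data.Product using (∃; _×_; _,_)
open import Data.Sum using (_⊎_; inj₁; inj₂)
open import Data.Unit using (tt)
open import Data.Vec using ([]; _∷_; lookup)
open import Function using (_∘_; _⇔_; mk⇔; Equivalence)
open import Relation.Nullary using (¬_; Dec; does; yes; no)
open import Relation.Nullary.Decidable using (dec-true; dec-false)
open import Relation.Unary using (Pred; Decidable)
open import Relation.Binary.PropositionalEquality using (_≡_)
import Relation.Binary.PropositionalEquality as ≡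
import Relation.Binary.Reasoning.Setoid as ≈-Reasoning

open Equivalence using (to; from)

T-not : ∀ {b} → T (not b) ⇔ (¬ T b)
T-not {true} = mk⇔ (λ ()) (λ ¬t → ¬t tt)
T-not {false} = mk⇔ (λ _ ()) (λ _ → tt)

T-injective : ∀ {a b} → (T a → T b) → (T b → T a) → a ≡ b
T-injective {true} {true} _ _ = ≡.refl
T-injective {true} {false} a⇒b _ = ⊥-elim (a⇒b tt)
T-injective {false} {true} _ b⇒a = ⊥-elim (b⇒a tt)
T-injective {false} {false} _ _ = ≡.refl

if-T : ∀ {a} {A : Set a} {b} {x y : A} → T b → (if b then x else y) ≡ x
if-T {b = true} _ = ≡.refl

T-all-allFin : ∀ {n} (g : Fin n → Bool) → T (all g (allFin n)) ⇔ (∀ v → T (g v))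
T-all-allFin g = mk⇔ (λ h v → All.lookup (all⁺ g _ h) (∈-allFin v))
                     (λ h → all⁻ g {xs = allFin _} (All.tabulate (λ {v} _ → h v)))

T-any-allFin : ∀ {n} (g : Fin n → Bool) → T (any g (allFin n)) ⇔ ∃ (T ∘ g)
T-any-allFin g = mk⇔ (λ h → satisfied (any⁻ g (allFin _) h))
                     (λ { (v , t) → any⁺ g (lose (∈-allFin v) t) })

map-allFin-suc : ∀ {a} {A : Set a} {n} (f : Fin (suc n) → A) →
  map f (allFin (suc n)) ≡ f Fin.zero ∷ map (f ∘ Fin.suc) (allFin n)
map-allFin-suc f =
  ≡.trans (map-tabulate (λ v → v) f) (≡.cong (f Fin.zero ∷_) (≡.sym (map-tabulate (λ v → v) (f ∘ Fin.suc))))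

select : ∀ {a} {A : Set a} {n} → Subset n → (Fin n → A) → (Fin n → A) → Fin n → A
select J x y v = if lookup J v then x v else y v

module BigOperators {c ℓ : Level} (S : CommutativeSemiring c ℓ) where
  open CommutativeSemiring S hiding (zero)
  open ≈-Reasoning setoid
  open import Algebra.Properties.CommutativeSemigroup +-commutativeSemigroup
    using () renaming (interchange to +-interchange)
  open import Algebra.Properties.CommutativeSemigroup *-commutativeSemigroup
    using () renaming (interchange to *-interchange)

  ∑ : ∀ {a} {A : Set a} → List A → (A → Carrier) → Carrier
  ∑ xs f = foldr _+_ 0# (map f xs)

  ∏ : ∀ {a} {A : Set a} → List A → (A → Carrier) → Carrier
  ∏ xs f = foldr _*_ 1# (map f xs)

  ∑ᶠ ∏ᶠ : ∀ {n} → (Fin n → Carrier) → Carrier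
  ∑ᶠ {n} = ∑ (allFin n)
  ∏ᶠ {n} = ∏ (allFin n)

  ⟦_⟧ : Bool → Carrier
  ⟦ b ⟧ = if b then 1# else 0#

  module _ {a} {A : Set a} where

    ∑-cong : ∀ (xs : List A) {f g : A → Carrier} → (∀ x → f x ≈ g x) → ∑ xs f ≈ ∑ xs g
    ∑-cong [] _ = refl
    ∑-cong (x ∷ xs) f≈g = +-cong (f≈g x) (∑-cong xs f≈g)

    ∏-cong : ∀ (xs : List A) {f g : A → Carrier} → (∀ x → f x ≈ g x) → ∏ xs f ≈ ∏ xs g
    ∏-cong [] _ = refl
    ∏-cong (x ∷ xs) f≈g = *-cong (f≈g x) (∏-cong xs f≈g)

    ∑-0 : ∀ (xs : List A) → ∑ xs (λ _ → 0#) ≈ 0#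
    ∑-0 [] = refl
    ∑-0 (x ∷ xs) = trans (+-cong refl (∑-0 xs)) (+-identityʳ 0#)

    ∑-+ : ∀ (xs : List A) (f g : A → Carrier) → ∑ xs (λ x → f x + g x) ≈ ∑ xs f + ∑ xs g
    ∑-+ [] f g = sym (+-identityʳ 0#)
    ∑-+ (x ∷ xs) f g = trans (+-cong refl (∑-+ xs f g)) (+-interchange (f x) (g x) (∑ xs f) (∑ xs g))

    ∏-* : ∀ (xs : List A) (f g : A → Carrier) → ∏ xs (λ x → f x * g x) ≈ ∏ xs f * ∏ xs g
    ∏-* [] f g = sym (*-identityʳ 1#)
    ∏-* (x ∷ xs) f g = trans (*-cong refl (∏-* xs f g)) (*-interchange (f x) (g x) (∏ xs f) (∏ xs g))

    ∑-distribˡ : ∀ (xs : List A) (k : Carrier) (f : A → Carrier) → k * ∑ xs f ≈ ∑ xs (λ x → k * f x)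
    ∑-distribˡ [] k f = zeroʳ k
    ∑-distribˡ (x ∷ xs) k f = trans (distribˡ k (f x) (∑ xs f)) (+-cong refl (∑-distribˡ xs k f))

    ∑-distribʳ : ∀ (xs : List A) (k : Carrier) (f : A → Carrier) → ∑ xs f * k ≈ ∑ xs (λ x → f x * k)
    ∑-distribʳ xs k f = trans (*-comm _ k) (trans (∑-distribˡ xs k f) (∑-cong xs (λ x → *-comm k (f x))))

    ∑-++ : ∀ (xs ys : List A) (f : A → Carrier) → ∑ (xs ++ ys) f ≈ ∑ xs f + ∑ ys f
    ∑-++ [] ys f = sym (+-identityˡ _)
    ∑-++ (x ∷ xs) ys f = trans (+-cong refl (∑-++ xs ys f)) (sym (+-assoc _ _ _))

    ∑-filter : ∀ {p} {P : Pred A p} (P? : Decidable P) (xs : List A) (f : A → Carrier) →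
      ∑ (filter P? xs) f ≈ ∑ xs (λ x → if does (P? x) then f x else 0#)
    ∑-filter P? [] f = refl
    ∑-filter P? (x ∷ xs) f with does (P? x)
    ... | true = +-cong refl (∑-filter P? xs f)
    ... | false = trans (∑-filter P? xs f) (sym (+-identityˡ _))

    ∑-split : ∀ {p} {P : Pred A p} (P? : Decidable P) (xs : List A) (f : A → Carrier) →
      ∑ xs f ≈ ∑ (filter P? xs) f + ∑ xs (λ x → if does (P? x) then 0# else f x)
    ∑-split P? xs f = trans (∑-cong xs split) (trans (∑-+ xs _ _) (+-cong (sym (∑-filter P? xs f)) refl))
      where
      split : ∀ x → f x ≈ (if does (P? x) then f x else 0#) + (if does (P? x) then 0# else f x)
      split x with does (P? x)
      ... | true = sym (+-identityʳ _)
      ... | false = sym (+-identityˡ _)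

    ⟦all⟧ : ∀ (g : A → Bool) (xs : List A) → ⟦ all g xs ⟧ ≈ ∏ xs (λ x → ⟦ g x ⟧)
    ⟦all⟧ g [] = refl
    ⟦all⟧ g (x ∷ xs) with g x
    ... | true = trans (⟦all⟧ g xs) (sym (*-identityˡ _))
    ... | false = sym (zeroˡ _)

  module _ {a b} {A : Set a} {B : Set b} where

    ∑-map : ∀ (g : A → B) (xs : List A) (f : B → Carrier) → ∑ (map g xs) f ≈ ∑ xs (f ∘ g)
    ∑-map g [] f = refl
    ∑-map g (x ∷ xs) f = +-cong refl (∑-map g xs f)

    ∑-comm : ∀ (xs : List A) (ys : List B) (f : A → B → Carrier) →
      ∑ xs (λ x → ∑ ys (f x)) ≈ ∑ ys (λ y → ∑ xs (λ x → f x y))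
    ∑-comm [] ys f = sym (∑-0 ys)
    ∑-comm (x ∷ xs) ys f = trans (+-cong refl (∑-comm xs ys f)) (sym (∑-+ ys (f x) _))

  ∑ᶠ-suc : ∀ {n} (f : Fin (suc n) → Carrier) → ∑ᶠ f ≡ f Fin.zero + ∑ᶠ (f ∘ Fin.suc)
  ∑ᶠ-suc f = ≡.cong (foldr _+_ 0#) (map-allFin-suc f)

  ∏ᶠ-suc : ∀ {n} (f : Fin (suc n) → Carrier) → ∏ᶠ f ≡ f Fin.zero * ∏ᶠ (f ∘ Fin.suc)
  ∏ᶠ-suc f = ≡.cong (foldr _*_ 1#) (map-allFin-suc f)

  ∏ᶠ-cong : ∀ {n} {f g : Fin n → Carrier} → (∀ v → f v ≈ g v) → ∏ᶠ f ≈ ∏ᶠ g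
  ∏ᶠ-cong {n} = ∏-cong (allFin n)

  ∑-allSubsets-suc : ∀ n (f : Subset (suc n) → Carrier) →
    ∑ (allSubsets (suc n)) f ≈ ∑ (allSubsets n) (f ∘ (false ∷_)) + ∑ (allSubsets n) (f ∘ (true ∷_))
  ∑-allSubsets-suc n f = trans (∑-++ (map (false ∷_) (allSubsets n)) _ f)
    (+-cong (∑-map (false ∷_) (allSubsets n) f) (∑-map (true ∷_) (allSubsets n) f))

  ∏ᶠ-+ : ∀ n (a b : Fin n → Carrier) → ∏ᶠ (λ v → a v + b v) ≈ ∑ (allSubsets n) (λ J → ∏ᶠ (select J a b))
  ∏ᶠ-+ zero a b = sym (+-identityʳ 1#)
  ∏ᶠ-+ (suc n) a b = begin
    ∏ᶠ (λ v → a v + b v)                                        ≡⟨ ∏ᶠ-suc (λ v → a v + b v) ⟩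
    (a₀ + b₀) * ∏ᶠ (λ v → a′ v + b′ v)                          ≈⟨ *-cong (+-comm a₀ b₀) (∏ᶠ-+ n a′ b′) ⟩
    (b₀ + a₀) * ∑ subsets term                                  ≈⟨ distribʳ _ b₀ a₀ ⟩
    b₀ * ∑ subsets term + a₀ * ∑ subsets term                   ≈⟨ +-cong (∑-distribˡ subsets b₀ term) (∑-distribˡ subsets a₀ term) ⟩
    ∑ subsets (λ J → b₀ * term J) + ∑ subsets (λ J → a₀ * term J)
      ≈⟨ +-cong (∑-cong subsets (λ J → reflexive (≡.sym (∏ᶠ-suc (select (false ∷ J) a b)))))
                (∑-cong subsets (λ J → reflexive (≡.sym (∏ᶠ-suc (select (true ∷ J) a b))))) ⟩
    ∑ subsets (λ J → ∏ᶠ (select (false ∷ J) a b)) + ∑ subsets (λ J → ∏ᶠ (select (true ∷ J) a b))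
      ≈⟨ ∑-allSubsets-suc n (λ J → ∏ᶠ (select J a b)) ⟨
    ∑ (allSubsets (suc n)) (λ J → ∏ᶠ (select J a b))            ∎
    where
    a₀ = a Fin.zero
    b₀ = b Fin.zero
    a′ = a ∘ Fin.suc
    b′ = b ∘ Fin.suc
    subsets = allSubsets n
    term : Subset n → Carrier
    term J = ∏ᶠ (select J a′ b′)

module ℕ-BigOperators where
  open BigOperators ℕ.+-*-commutativeSemiring public

  ⟦⟧≤1 : ∀ b → ⟦ b ⟧ ≤ 1
  ⟦⟧≤1 true = s≤s z≤n
  ⟦⟧≤1 false = z≤n

  ⟦⟧+⟦⟧≤1 : ∀ {a b} → ¬ (T a × T b) → ⟦ a ⟧ ℕ.+ ⟦ b ⟧ ≤ 1
  ⟦⟧+⟦⟧≤1 {true} {true} ¬ab = ⊥-elim (¬ab (tt , tt))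
  ⟦⟧+⟦⟧≤1 {true} {false} _ = s≤s z≤n
  ⟦⟧+⟦⟧≤1 {false} {b} _ = ⟦⟧≤1 b

  ⟦⟧+⟦⟧≡0 : ∀ {a b} → ¬ T a → ¬ T b → ⟦ a ⟧ ℕ.+ ⟦ b ⟧ ≡ 0
  ⟦⟧+⟦⟧≡0 {true} ¬a _ = ⊥-elim (¬a tt)
  ⟦⟧+⟦⟧≡0 {false} {true} _ ¬b = ⊥-elim (¬b tt)
  ⟦⟧+⟦⟧≡0 {false} {false} _ _ = ≡.refl

  ∑ᶠ≤n : ∀ {n} (f : Fin n → ℕ) → (∀ u → f u ≤ 1) → ∑ᶠ f ≤ n
  ∑ᶠ≤n {zero} f _ = z≤n
  ∑ᶠ≤n {suc n} f f≤1 rewrite ∑ᶠ-suc f = ℕ.+-mono-≤ (f≤1 Fin.zero) (∑ᶠ≤n (f ∘ Fin.suc) (f≤1 ∘ Fin.suc))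

  ∑ᶠ<n : ∀ {n} (f : Fin n → ℕ) → (∀ u → f u ≤ 1) → ∀ v → f v ≡ 0 → ∑ᶠ f < n
  ∑ᶠ<n {suc n} f f≤1 Fin.zero f₀≡0 rewrite ∑ᶠ-suc f | f₀≡0 = s≤s (∑ᶠ≤n (f ∘ Fin.suc) (f≤1 ∘ Fin.suc))
  ∑ᶠ<n {suc n} f f≤1 (Fin.suc v) fv≡0 rewrite ∑ᶠ-suc f =
    ℕ.+-mono-≤-< (f≤1 Fin.zero) (∑ᶠ<n (f ∘ Fin.suc) (f≤1 ∘ Fin.suc) v fv≡0)

  ∣p∣≡∑ᶠ : ∀ {n} (J : Subset n) → ∣ J ∣ ≡ ∑ᶠ (λ u → ⟦ lookup J u ⟧)
  ∣p∣≡∑ᶠ [] = ≡.refl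
  ∣p∣≡∑ᶠ (true ∷ J) = ≡.trans (≡.cong suc (∣p∣≡∑ᶠ J)) (≡.sym (∑ᶠ-suc (λ u → ⟦ lookup (true ∷ J) u ⟧)))
  ∣p∣≡∑ᶠ (false ∷ J) = ≡.trans (∣p∣≡∑ᶠ J) (≡.sym (∑ᶠ-suc (λ u → ⟦ lookup (false ∷ J) u ⟧)))

module _ {n : ℕ} (G : Graph n) where
  open ℕ-BigOperators

  Close : Fin n → Fin n → Set
  Close u v = u ≡ v ⊎ T (adj G u v)

  Close-sym : ∀ {u v} → Close u v → Close v u
  Close-sym (inj₁ u≡v) = inj₁ (≡.sym u≡v)
  Close-sym {u} {v} (inj₂ uv) = inj₂ (≡.subst T (Graph.sym G u v) uv)

  ∈N[]⇔ : ∀ (J : Subset n) v → T (inClosedNbhd G J v) ⇔ ∃ λ u → T (lookup J u) × Close u v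
  ∈N[]⇔ J v = mk⇔ ⇒ ⇐
    where
    ⇒ : T (inClosedNbhd G J v) → ∃ λ u → T (lookup J u) × Close u v
    ⇒ v∈N with to (T-∨ {lookup J v}) v∈N
    ... | inj₁ v∈J = v , v∈J , inj₁ ≡.refl
    ... | inj₂ t =
      let u , u∈J∧uv = to (T-any-allFin (λ u → lookup J u ∧ adj G u v)) t
          u∈J , uv = to T-∧ u∈J∧uv
      in u , u∈J , inj₂ uv

    ⇐ : (∃ λ u → T (lookup J u) × Close u v) → T (inClosedNbhd G J v)
    ⇐ (u , u∈J , inj₁ ≡.refl) = from T-∨ (inj₁ u∈J)
    ⇐ (u , u∈J , inj₂ uv) =
      from (T-∨ {lookup J v}) (inj₂ (from (T-any-allFin (λ u → lookup J u ∧ adj G u v)) (u , from T-∧ (u∈J , uv))))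

  avoids : Subset n → Subset n → Bool
  avoids J S = all (λ v → not (lookup J v ∧ inClosedNbhd G S v)) (allFin n)

  Separated : Subset n → Subset n → Set
  Separated J S = ∀ {u v} → T (lookup J u) → T (lookup S v) → ¬ Close u v

  Separated-sym : ∀ {J S} → Separated J S → Separated S J
  Separated-sym sep v∈S u∈J c = sep u∈J v∈S (Close-sym c)

  avoids⇔Separated : ∀ J S → T (avoids J S) ⇔ Separated J S
  avoids⇔Separated J S = mk⇔ ⇒ ⇐
    where
    ⇒ : T (avoids J S) → Separated J S
    ⇒ h {u} {v} u∈J v∈S c =
      to T-not (to (T-all-allFin _) h u) (from T-∧ (u∈J , from (∈N[]⇔ S u) (v , v∈S , Close-sym c)))

    ⇐ : Separated J S → T (avoids J S)
    ⇐ sep = from (T-all-allFin _) λ v → from T-not λ v∈J∩N →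
      let v∈J , v∈N = to T-∧ v∈J∩N
          u , u∈S , c = to (∈N[]⇔ S v) v∈N
      in sep v∈J u∈S (Close-sym c)

  avoids-sym : ∀ J S → avoids J S ≡ avoids S J
  avoids-sym J S = T-injective
    (from (avoids⇔Separated S J) ∘ Separated-sym {J} {S} ∘ to (avoids⇔Separated J S))
    (from (avoids⇔Separated J S) ∘ Separated-sym {S} {J} ∘ to (avoids⇔Separated S J))

  degree≤n : ∀ v → degree G v ≤ n
  degree≤n v = ∑ᶠ≤n (λ u → ⟦ adj G v u ⟧) (λ u → ⟦⟧≤1 (adj G v u))

  -- J and the neighbours of v are disjoint, and v lies in neither.
  ∉N[]⇒∣J∣+degree<n : ∀ J v → ¬ T (inClosedNbhd G J v) → ∣ J ∣ ℕ.+ degree G v < n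
  ∉N[]⇒∣J∣+degree<n J v v∉N = ≡.subst (_< n) ∑ᶠf≡ (∑ᶠ<n f f≤1 v fv≡0)
    where
    f : Fin n → ℕ
    f u = ⟦ lookup J u ⟧ ℕ.+ ⟦ adj G v u ⟧

    ∑ᶠf≡ : ∑ᶠ f ≡ ∣ J ∣ ℕ.+ degree G v
    ∑ᶠf≡ = ≡.trans (∑-+ (allFin n) _ _) (≡.cong (ℕ._+ degree G v) (≡.sym (∣p∣≡∑ᶠ J)))

    f≤1 : ∀ u → f u ≤ 1
    f≤1 u = ⟦⟧+⟦⟧≤1 λ (u∈J , vu) →
      v∉N (from (∈N[]⇔ J v) (u , u∈J , inj₂ (≡.subst T (Graph.sym G v u) vu)))

    fv≡0 : f v ≡ 0
    fv≡0 = ⟦⟧+⟦⟧≡0 (λ v∈J → v∉N (from (∈N[]⇔ J v) (v , v∈J , inj₁ ≡.refl)))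
                   (≡.subst T (irrefl G v))

  large⇒N[]-full : ∀ {δ} → (∀ v → δ ≤ degree G v) → ∀ J → n ∸ δ < ∣ J ∣ → ∀ v → T (inClosedNbhd G J v)
  large⇒N[]-full {δ} δ≤degree J large v with T? (inClosedNbhd G J v)
  ... | yes v∈N = v∈N
  ... | no v∉N = ⊥-elim (ℕ.<⇒≱ large (ℕ.m+n≤o⇒m≤o∸n ∣ J ∣ (ℕ.<⇒≤
          (ℕ.≤-<-trans (ℕ.+-monoʳ-≤ ∣ J ∣ (δ≤degree v)) (∉N[]⇒∣J∣+degree<n J v v∉N)))))

module SignedSums {c ℓ : Level} (R : CommutativeRing c ℓ) where
  open CommutativeRing R hiding (zero)
  open BigOperators commutativeSemiring public
  open ≈-Reasoning setoid
  open import Algebra.Properties.Ring ring using (-1*x≈-x)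
  open import Algebra.Properties.CommutativeSemigroup *-commutativeSemigroup
    using () renaming (interchange to *-interchange)

  fromℕ-+ : ∀ a b → fromℕ R (a ℕ.+ b) ≈ fromℕ R a + fromℕ R b
  fromℕ-+ zero b = sym (+-identityˡ _)
  fromℕ-+ (suc a) b = trans (+-cong refl (fromℕ-+ a b)) (sym (+-assoc _ _ _))

  ∏ᶠ-select-neg : ∀ {n} (J : Subset n) (y : Fin n → Carrier) →
    ∏ᶠ (select J (-_ ∘ y) (λ _ → 1#)) ≈ sign R ∣ J ∣ * ∏ᶠ (select J y (λ _ → 1#))
  ∏ᶠ-select-neg [] y = sym (*-identityʳ 1#)
  ∏ᶠ-select-neg (true ∷ J) y = begin
    ∏ᶠ (select (true ∷ J) (-_ ∘ y) one)           ≡⟨ ∏ᶠ-suc (select (true ∷ J) (-_ ∘ y) one) ⟩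
    - y₀ * ∏ᶠ (select J (-_ ∘ y′) one)            ≈⟨ *-cong (sym (-1*x≈-x y₀)) (∏ᶠ-select-neg J y′) ⟩
    (- 1# * y₀) * (sign R ∣ J ∣ * rest)           ≈⟨ *-interchange _ _ _ _ ⟩
    (- 1# * sign R ∣ J ∣) * (y₀ * rest)           ≡⟨ ≡.cong (sign R ∣ true ∷ J ∣ *_) (∏ᶠ-suc (select (true ∷ J) y one)) ⟨
    sign R ∣ true ∷ J ∣ * ∏ᶠ (select (true ∷ J) y one) ∎
    where
    one : ∀ {k} → Fin k → Carrier
    one _ = 1#
    y₀ = y Fin.zero
    y′ = y ∘ Fin.suc
    rest = ∏ᶠ (select J y′ one)
  ∏ᶠ-select-neg (false ∷ J) y = begin
    ∏ᶠ (select (false ∷ J) (-_ ∘ y) one)          ≡⟨ ∏ᶠ-suc (select (false ∷ J) (-_ ∘ y) one) ⟩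
    1# * ∏ᶠ (select J (-_ ∘ y′) one)              ≈⟨ *-identityˡ _ ⟩
    ∏ᶠ (select J (-_ ∘ y′) one)                   ≈⟨ ∏ᶠ-select-neg J y′ ⟩
    sign R ∣ J ∣ * rest                           ≈⟨ *-cong refl (*-identityˡ rest) ⟨
    sign R ∣ J ∣ * (1# * rest)                    ≡⟨ ≡.cong (sign R ∣ J ∣ *_) (∏ᶠ-suc (select (false ∷ J) y one)) ⟨
    sign R ∣ false ∷ J ∣ * ∏ᶠ (select (false ∷ J) y one) ∎
    where
    one : ∀ {k} → Fin k → Carrier
    one _ = 1#
    y′ = y ∘ Fin.suc
    rest = ∏ᶠ (select J y′ one)

  ∑-sign≈0 : ∀ n → ∑ (allSubsets (suc n)) (λ J → sign R ∣ J ∣) ≈ 0#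
  ∑-sign≈0 n = begin
    ∑ (allSubsets (suc n)) (λ J → sign R ∣ J ∣)            ≈⟨ ∑-allSubsets-suc n _ ⟩
    σ + ∑ (allSubsets n) (λ J → - 1# * sign R ∣ J ∣)       ≈⟨ +-cong refl (∑-distribˡ (allSubsets n) (- 1#) _) ⟨
    σ + - 1# * σ                                           ≈⟨ +-cong refl (-1*x≈-x σ) ⟩
    σ + - σ                                                ≈⟨ -‿inverseʳ σ ⟩
    0#                                                     ∎
    where
    σ = ∑ (allSubsets n) (λ J → sign R ∣ J ∣)

  signAbove : ∀ {n} → ℕ → Subset n → Carrier
  signAbove m J = if does (m <? ∣ J ∣) then sign R ∣ J ∣ else 0#

  signAbove-≤ : ∀ {n m} (J : Subset n) → ∣ J ∣ ≤ m → signAbove m J ≈ 0#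
  signAbove-≤ {m = m} J J≤m =
    reflexive (≡.cong (λ b → if b then sign R ∣ J ∣ else 0#) (dec-false (m <? ∣ J ∣) (ℕ.≤⇒≯ J≤m)))

  signAbove-> : ∀ {n m} (J : Subset n) → m < ∣ J ∣ → signAbove m J ≈ sign R ∣ J ∣
  signAbove-> {m = m} J m<J =
    reflexive (≡.cong (λ b → if b then sign R ∣ J ∣ else 0#) (dec-true (m <? ∣ J ∣) m<J))

  ∑-signAbove-[] : ∀ m → ∑ (allSubsets 0) (signAbove m) ≈ 0#
  ∑-signAbove-[] m = +-identityʳ 0#

  ∑-signAbove-suc-zero : ∀ n →
    ∑ (allSubsets (suc n)) (signAbove 0) ≈ ∑ (allSubsets n) (signAbove 0) + - 1# * ∑ (allSubsets n) (λ J → sign R ∣ J ∣)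
  ∑-signAbove-suc-zero n =
    trans (∑-allSubsets-suc n _) (+-cong refl (sym (∑-distribˡ (allSubsets n) (- 1#) _)))

  ∑-signAbove-suc-suc : ∀ n m →
    ∑ (allSubsets (suc n)) (signAbove (suc m)) ≈ ∑ (allSubsets n) (signAbove (suc m)) + - 1# * ∑ (allSubsets n) (signAbove m)
  ∑-signAbove-suc-suc n m = trans (∑-allSubsets-suc n _)
    (+-cong refl (trans (∑-cong (allSubsets n) (λ J → shift (does (m <? ∣ J ∣)) (sign R ∣ J ∣)))
                        (sym (∑-distribˡ (allSubsets n) (- 1#) _))))
    where
    shift : ∀ b x → (if b then - 1# * x else 0#) ≈ - 1# * (if b then x else 0#)
    shift true x = refl
    shift false x = sym (zeroʳ _)

  ∑-signAbove : ∀ n m → ∑ (allSubsets (suc n)) (signAbove m) ≈ sign R (suc m) * fromℕ R (n C m)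
  ∑-signAbove zero zero = begin
    ∑ (allSubsets 1) (signAbove 0)                          ≈⟨ ∑-signAbove-suc-zero 0 ⟩
    ∑ (allSubsets 0) (signAbove 0) + - 1# * (1# + 0#)       ≈⟨ +-cong (∑-signAbove-[] 0) refl ⟩
    0# + - 1# * (1# + 0#)                                   ≈⟨ +-identityˡ _ ⟩
    - 1# * (1# + 0#)                                        ≈⟨ *-cong (*-identityʳ (- 1#)) refl ⟨
    (- 1# * 1#) * (1# + 0#)                                 ∎
  ∑-signAbove zero (suc m) = begin
    ∑ (allSubsets 1) (signAbove (suc m))                    ≈⟨ ∑-signAbove-suc-suc 0 m ⟩
    ∑ (allSubsets 0) (signAbove (suc m)) + - 1# * ∑ (allSubsets 0) (signAbove m)
      ≈⟨ +-cong (∑-signAbove-[] (suc m)) (*-cong refl (∑-signAbove-[] m)) ⟩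
    0# + - 1# * 0#                                          ≈⟨ +-identityˡ _ ⟩
    - 1# * 0#                                               ≈⟨ zeroʳ _ ⟩
    0#                                                      ≈⟨ zeroʳ _ ⟨
    sign R (suc (suc m)) * 0#                               ∎
  ∑-signAbove (suc n) zero = begin
    ∑ (allSubsets (suc (suc n))) (signAbove 0)              ≈⟨ ∑-signAbove-suc-zero (suc n) ⟩
    ∑ (allSubsets (suc n)) (signAbove 0) + - 1# * ∑ (allSubsets (suc n)) (λ J → sign R ∣ J ∣)
      ≈⟨ +-cong (∑-signAbove n zero) (*-cong refl (∑-sign≈0 n)) ⟩
    sign R 1 * fromℕ R (n C 0) + - 1# * 0#                  ≈⟨ +-cong refl (zeroʳ _) ⟩
    sign R 1 * fromℕ R (n C 0) + 0#                         ≈⟨ +-identityʳ _ ⟩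
    sign R 1 * fromℕ R (suc n C 0)                          ∎
  ∑-signAbove (suc n) (suc m) = begin
    ∑ (allSubsets (suc (suc n))) (signAbove (suc m))        ≈⟨ ∑-signAbove-suc-suc (suc n) m ⟩
    ∑ (allSubsets (suc n)) (signAbove (suc m)) + - 1# * ∑ (allSubsets (suc n)) (signAbove m)
      ≈⟨ +-cong (∑-signAbove n (suc m)) (*-cong refl (∑-signAbove n m)) ⟩
    s * c₁ + - 1# * (sign R (suc m) * c₀)                   ≈⟨ +-cong refl (*-assoc _ _ _) ⟨
    s * c₁ + s * c₀                                         ≈⟨ distribˡ s c₁ c₀ ⟨
    s * (c₁ + c₀)                                           ≈⟨ *-cong refl (+-comm c₁ c₀) ⟩
    s * (c₀ + c₁)                                           ≈⟨ *-cong refl (fromℕ-+ (n C m) (n C suc m)) ⟨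
    s * fromℕ R (n C m ℕ.+ n C suc m)                       ≡⟨ ≡.cong (λ k → s * fromℕ R k) (nCk+nC[k+1]≡[n+1]C[k+1] n m) ⟩
    s * fromℕ R (suc n C suc m)                             ∎
    where
    s = sign R (suc (suc m))
    c₀ = fromℕ R (n C m)
    c₁ = fromℕ R (n C suc m)

module Reliability {c ℓ : Level} (R : CommutativeRing c ℓ) {n : ℕ} (G : Graph n)
                   (p : Fin n → CommutativeRing.Carrier R) where
  open CommutativeRing R hiding (zero)
  open SignedSums R
  open ≈-Reasoning setoid
  open import Algebra.Properties.AbelianGroup +-abelianGroup using (ε⁻¹≈ε)

  q : Fin n → Carrier
  q = qOf R p

  subsets : List (Subset n)
  subsets = allSubsets n

  stateProb : Subset n → Carrier
  stateProb S = ∏ᶠ (select S p q)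

  ⟦isDominating⟧ : ∀ S → ⟦ isDominating G S ⟧ ≈ ∑ subsets (λ J → sign R ∣ J ∣ * ⟦ avoids G J S ⟧)
  ⟦isDominating⟧ S = begin
    ⟦ isDominating G S ⟧                                                    ≈⟨ ⟦all⟧ N (allFin n) ⟩
    ∏ᶠ (λ v → ⟦ N v ⟧)                                                      ≈⟨ ∏ᶠ-cong (λ v → complement (N v)) ⟩
    ∏ᶠ (λ v → - y v + 1#)                                                   ≈⟨ ∏ᶠ-+ n (-_ ∘ y) (λ _ → 1#) ⟩
    ∑ subsets (λ J → ∏ᶠ (select J (-_ ∘ y) (λ _ → 1#)))                     ≈⟨ ∑-cong subsets (λ J → ∏ᶠ-select-neg J y) ⟩
    ∑ subsets (λ J → sign R ∣ J ∣ * ∏ᶠ (select J y (λ _ → 1#)))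
      ≈⟨ ∑-cong subsets (λ J → *-cong refl (∏ᶠ-cong (λ v → select-⟦not⟧ (lookup J v) (N v)))) ⟩
    ∑ subsets (λ J → sign R ∣ J ∣ * ∏ᶠ (λ v → ⟦ not (lookup J v ∧ N v) ⟧))
      ≈⟨ ∑-cong subsets (λ J → *-cong refl (⟦all⟧ (λ v → not (lookup J v ∧ N v)) (allFin n))) ⟨
    ∑ subsets (λ J → sign R ∣ J ∣ * ⟦ avoids G J S ⟧)                       ∎
    where
    N : Fin n → Bool
    N = inClosedNbhd G S
    y : Fin n → Carrier
    y v = ⟦ not (N v) ⟧
    complement : ∀ b → ⟦ b ⟧ ≈ - ⟦ not b ⟧ + 1#
    complement true = sym (trans (+-cong ε⁻¹≈ε refl) (+-identityˡ 1#))
    complement false = sym (-‿inverseˡ 1#)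
    select-⟦not⟧ : ∀ j b → (if j then ⟦ not b ⟧ else 1#) ≈ ⟦ not (j ∧ b) ⟧
    select-⟦not⟧ true b = refl
    select-⟦not⟧ false b = refl

  -- Only the S missing N[J] contribute; summing their probabilities frees every vertex outside N[J].
  ∑-avoids-stateProb : ∀ J → ∑ subsets (λ S → ⟦ avoids G S J ⟧ * stateProb S) ≈ prodQClosedNbhd R G p J
  ∑-avoids-stateProb J = begin
    ∑ subsets (λ S → ⟦ avoids G S J ⟧ * stateProb S)                           ≈⟨ ∑-cong subsets restrict ⟩
    ∑ subsets (λ S → ∏ᶠ (select S (λ v → ⟦ not (N v) ⟧ * p v) q))              ≈⟨ ∏ᶠ-+ n _ q ⟨
    ∏ᶠ (λ v → ⟦ not (N v) ⟧ * p v + q v)                                       ≈⟨ ∏ᶠ-cong (λ v → free (N v) (p v)) ⟩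
    prodQClosedNbhd R G p J                                                   ∎
    where
    N : Fin n → Bool
    N = inClosedNbhd G J

    mask : ∀ s b {x y} → ⟦ not (s ∧ b) ⟧ * (if s then x else y) ≈ (if s then ⟦ not b ⟧ * x else y)
    mask true b = refl
    mask false b = *-identityˡ _

    free : ∀ b x → ⟦ not b ⟧ * x + (1# - x) ≈ (if b then 1# - x else 1#)
    free true x = trans (+-cong (zeroˡ x) refl) (+-identityˡ _)
    free false x = begin
      1# * x + (1# + - x)   ≈⟨ +-cong (*-identityˡ x) (+-comm 1# (- x)) ⟩
      x + (- x + 1#)        ≈⟨ +-assoc _ _ _ ⟨
      (x + - x) + 1#        ≈⟨ +-cong (-‿inverseʳ x) refl ⟩
      0# + 1#               ≈⟨ +-identityˡ 1# ⟩
      1#                    ∎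

    restrict : ∀ S → ⟦ avoids G S J ⟧ * stateProb S ≈ ∏ᶠ (select S (λ v → ⟦ not (N v) ⟧ * p v) q)
    restrict S = begin
      ⟦ avoids G S J ⟧ * stateProb S
        ≈⟨ *-cong (⟦all⟧ (λ v → not (lookup S v ∧ N v)) (allFin n)) refl ⟩
      ∏ᶠ (λ v → ⟦ not (lookup S v ∧ N v) ⟧) * stateProb S
        ≈⟨ ∏-* (allFin n) _ _ ⟨
      ∏ᶠ (λ v → ⟦ not (lookup S v ∧ N v) ⟧ * select S p q v)
        ≈⟨ ∏ᶠ-cong (λ v → mask (lookup S v) (N v)) ⟩
      ∏ᶠ (select S (λ v → ⟦ not (N v) ⟧ * p v) q) ∎

  DRel≈∑-sign-prodQ : DRel R G p ≈ ∑ subsets (λ J → sign R ∣ J ∣ * prodQClosedNbhd R G p J)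
  DRel≈∑-sign-prodQ = begin
    DRel R G p
      ≈⟨ ∑-filter (λ S → T? (isDominating G S)) subsets stateProb ⟩
    ∑ subsets (λ S → if isDominating G S then stateProb S else 0#)
      ≈⟨ ∑-cong subsets (λ S → indicator (isDominating G S)) ⟩
    ∑ subsets (λ S → ⟦ isDominating G S ⟧ * stateProb S)
      ≈⟨ ∑-cong subsets (λ S → trans (*-cong (⟦isDominating⟧ S) refl) (∑-distribʳ subsets _ _)) ⟩
    ∑ subsets (λ S → ∑ subsets (λ J → sign R ∣ J ∣ * ⟦ avoids G J S ⟧ * stateProb S))
      ≈⟨ ∑-comm subsets subsets _ ⟩
    ∑ subsets (λ J → ∑ subsets (λ S → sign R ∣ J ∣ * ⟦ avoids G J S ⟧ * stateProb S))
      ≈⟨ ∑-cong subsets (λ J → trans (∑-cong subsets (swap J)) (sym (∑-distribˡ subsets _ _))) ⟩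
    ∑ subsets (λ J → sign R ∣ J ∣ * ∑ subsets (λ S → ⟦ avoids G S J ⟧ * stateProb S))
      ≈⟨ ∑-cong subsets (λ J → *-cong refl (∑-avoids-stateProb J)) ⟩
    ∑ subsets (λ J → sign R ∣ J ∣ * prodQClosedNbhd R G p J) ∎
    where
    indicator : ∀ b {x} → (if b then x else 0#) ≈ ⟦ b ⟧ * x
    indicator true = sym (*-identityˡ _)
    indicator false = sym (zeroˡ _)

    swap : ∀ J S → sign R ∣ J ∣ * ⟦ avoids G J S ⟧ * stateProb S ≈ sign R ∣ J ∣ * (⟦ avoids G S J ⟧ * stateProb S)
    swap J S = trans (*-assoc _ _ _) (*-cong refl (*-cong (reflexive (≡.cong ⟦_⟧ (avoids-sym G J S))) refl))

  ∑-large-terms : ∀ {δ} → (∀ v → δ ≤ degree G v) →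
    ∑ subsets (λ J → if does (∣ J ∣ ≤? n ∸ δ) then 0# else sign R ∣ J ∣ * prodQClosedNbhd R G p J)
      ≈ ∑ subsets (signAbove (n ∸ δ)) * ∏ᶠ q
  ∑-large-terms {δ} δ≤degree = trans (∑-cong subsets (λ J → term J (∣ J ∣ ≤? n ∸ δ))) (sym (∑-distribʳ subsets _ _))
    where
    term : ∀ J (small? : Dec (∣ J ∣ ≤ n ∸ δ)) →
      (if does small? then 0# else sign R ∣ J ∣ * prodQClosedNbhd R G p J) ≈ signAbove (n ∸ δ) J * ∏ᶠ q
    term J (yes small) = trans (sym (zeroˡ _)) (*-cong (sym (signAbove-≤ J small)) refl)
    term J (no ¬small) = *-cong (sym (signAbove-> J large))
                                (∏ᶠ-cong (λ v → reflexive (if-T (large⇒N[]-full G δ≤degree J large v))))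
      where large = ℕ.≰⇒> ¬small

corollary2 : ∀ {c ℓ : Level} (R : CommutativeRing c ℓ) (n : ℕ) (G : Graph n) (δ : ℕ)
    → 1 ≤ n → IsMinDegree G δ → 1 ≤ δ → (p : Fin n → CommutativeRing.Carrier R)
    → CommutativeRing._≈_ R (DRel R G p)
        (CommutativeRing._+_ R
          (sumR R (map (λ J → CommutativeRing._*_ R (sign R ∣ J ∣) (prodQClosedNbhd R G p J))
                       (filter (λ J → ∣ J ∣ ≤? (n ∸ δ)) (allSubsets n))))
          (CommutativeRing._*_ R
            (CommutativeRing._*_ R (sign R (suc (n ∸ δ))) (fromℕ R ((n ∸ 1) C (δ ∸ 1))))
            (prodR R (map (qOf R p) (allFin n)))))
corollary2 R (suc n) G (suc d) (s≤s z≤n) (δ≤degree , _) (s≤s z≤n) p = begin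
    DRel R G p                                                  ≈⟨ DRel≈∑-sign-prodQ ⟩
    ∑ subsets term                                              ≈⟨ ∑-split (λ J → ∣ J ∣ ≤? m) subsets term ⟩
    ∑ small term + ∑ subsets (λ J → if does (∣ J ∣ ≤? m) then 0# else term J)
                                                                ≈⟨ +-cong refl (∑-large-terms δ≤degree) ⟩
    ∑ small term + ∑ subsets (signAbove m) * ∏ᶠ q               ≈⟨ +-cong refl (*-cong (∑-signAbove n m) refl) ⟩
    ∑ small term + sign R (suc m) * fromℕ R (n C m) * ∏ᶠ q     ≡⟨ ≡.cong (λ k → ∑ small term + sign R (suc m) * fromℕ R k * ∏ᶠ q) nC[n∸d]≡nCd ⟩
    ∑ small term + sign R (suc m) * fromℕ R (n C d) * ∏ᶠ q     ∎
  where
  open CommutativeRing R hiding (zero)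
  open SignedSums R
  open Reliability R G p
  open ≈-Reasoning setoid
  m = n ∸ d
  term : Subset (suc n) → Carrier
  term J = sign R ∣ J ∣ * prodQClosedNbhd R G p J
  small : List (Subset (suc n))
  small = filter (λ J → ∣ J ∣ ≤? m) subsets
  nC[n∸d]≡nCd : n C (n ∸ d) ≡ n C d
  nC[n∸d]≡nCd = ≡.sym (nCk≡nC[n∸k] (ℕ.≤-pred (ℕ.≤-trans (δ≤degree Fin.zero) (degree≤n G Fin.zero))))
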